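{- Let $G$ be a finite simple König–Egerváry graph, $M$ a maximum matching of $G$, and $H$ a subgraph of $G$ such that $M=(M\cap E(H))\cup(M\cap E(G-H))$. Then (i) $H$ and $G-H$ are König–Egerváry graphs; (ii) $\alpha(G)=\alpha(H)+\alpha(G-H)$.
   Context: $\alpha(G)$ is the maximum size of a stable set, $\mu(G)$ the maximum size of a matching; $G$ is a König–Egerváry graph if $\alpha(G)+\mu(G)=|V(G)|$. $G-H$ denotes the subgraph of $G$ induced by $V(G)-V(H)$. -}

module Defs where

open import Data.Nat using (ℕ; _+_; _≤_)
open import Data.Fin using (Fin)
open import Data.Fin.Subset using (Subset; _∈_; _∉_; _⊆_; ∣_∣; ⊤; ∁)
open import Data.Product using (_×_; _,_; Σ; ∃; ∃-syntax)
open import Data.Sum using (_⊎_)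
open import Data.List using (List; length; concatMap; _∷_; [])
open import Data.List.Relation.Unary.All using (All)
open import Data.List.Relation.Unary.Unique.Propositional using (Unique)
open import Relation.Nullary using (¬_)
open import Relation.Binary.PropositionalEquality using (_≡_)

record SimpleGraph (n : ℕ) : Set₁ where
  field
    Adj     : Fin n → Fin n → Set
    sym     : ∀ {i j} → Adj i j → Adj j i
    irrefl  : ∀ {i} → ¬ Adj i i
open SimpleGraph public

record Graph (n : ℕ) : Set₁ where
  field
    V     : Subset n
    E     : Fin n → Fin n → Set
    E-sym : ∀ {i j} → E i j → E j i
    E-irr : ∀ {i} → ¬ E i i
    E-in  : ∀ {i j} → E i j → i ∈ V × j ∈ V
open Graph public

full : ∀ {n} → SimpleGraph n → Graph n
full G = record
  { V = ⊤ ; E = Adj G ; E-sym = sym G ; E-irr = irrefl G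
  ; E-in = λ _ → Data.Fin.Subset.Properties.∈⊤ , Data.Fin.Subset.Properties.∈⊤ }
  where import Data.Fin.Subset.Properties

-- A (not necessarily induced) subgraph H of G: a vertex subset together with
-- a symmetric set of edges of G having both ends in that subset.
record Subgraph {n : ℕ} (G : SimpleGraph n) : Set₁ where
  field
    VH     : Subset n
    EH     : Fin n → Fin n → Set
    EH-sym : ∀ {i j} → EH i j → EH j i
    EH⊆E   : ∀ {i j} → EH i j → Adj G i j
    EH-in  : ∀ {i j} → EH i j → i ∈ VH × j ∈ VH
open Subgraph public

asGraph : ∀ {n} {G : SimpleGraph n} → Subgraph G → Graph n
asGraph {G = G} H = record
  { V = VH H ; E = EH H ; E-sym = EH-sym H
  ; E-irr = λ e → irrefl G (EH⊆E H e) ; E-in = EH-in H }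

minus : ∀ {n} (G : SimpleGraph n) → Subgraph G → Graph n
minus G H = record
  { V = ∁ (VH H)
  ; E = λ i j → Adj G i j × i ∈ ∁ (VH H) × j ∈ ∁ (VH H)
  ; E-sym = λ { (a , p , q) → sym G a , q , p }
  ; E-irr = λ { (a , _ , _) → irrefl G a }
  ; E-in = λ { (_ , p , q) → p , q } }

IsStable : ∀ {n} → Graph n → Subset n → Set
IsStable g S = (S ⊆ V g) × (∀ {i j} → i ∈ S → j ∈ S → ¬ E g i j)

IsAlpha : ∀ {n} → Graph n → ℕ → Set
IsAlpha g k = (∃[ S ] (IsStable g S × ∣ S ∣ ≡ k))
            × (∀ S → IsStable g S → ∣ S ∣ ≤ k)

-- Matchings: lists of edges whose endpoints are pairwise distinct
-- (so edges are distinct and pairwise vertex-disjoint); size = length.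
endpoints : ∀ {n} → List (Fin n × Fin n) → List (Fin n)
endpoints = concatMap (λ { (i , j) → i ∷ j ∷ [] })

IsMatching : ∀ {n} → Graph n → List (Fin n × Fin n) → Set
IsMatching g M = All (λ { (i , j) → E g i j }) M × Unique (endpoints M)

IsMaxMatching : ∀ {n} → Graph n → List (Fin n × Fin n) → Set
IsMaxMatching g M = IsMatching g M
                  × (∀ M' → IsMatching g M' → length M' ≤ length M)

IsMu : ∀ {n} → Graph n → ℕ → Set
IsMu g k = ∃[ M ] (IsMaxMatching g M × length M ≡ k)

IsKE : ∀ {n} → Graph n → Set
IsKE g = ∃[ a ] ∃[ m ] (IsAlpha g a × IsMu g m × a + m ≡ ∣ V g ∣)

{-# OPTIONS --safe #-}
module Submission where

-- Every edge of a matching M has an endpoint outside a stable set S, and these endpoints are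
-- distinct, so |S| + |M| ≤ |V|; a graph is König–Egerváry exactly when some S and M attain
-- equality. Cutting a maximum stable set of G and the given maximum matching along V(H) yields
-- stable sets and matchings of H and G - H whose two bounds add up to the tight bound for G,
-- so both bounds are tight.

open import Defs hiding (sym)
open import Data.Nat using (ℕ; _+_; suc; _≤_; s≤s)
open import Data.Nat.Properties
open import Algebra.Properties.CommutativeSemigroup +-commutativeSemigroup
  using () renaming (interchange to +-interchange)
open import Data.Fin using (Fin)
open import Data.Fin.Subset using (Subset; _∈_; _∉_; _⊆_; ∣_∣; ∁; _∩_; _-_; inside; outside)
open import Data.Fin.Subset.Properties
  using (_∈?_; p⊆q⇒∣p∣≤∣q∣; ∣⊤∣≡n; ∣∁p∣≡n∸∣p∣; ∣p∣≤n; x∈p∩q⁻; x∈p∧x≢y⇒x∈p-y; x∈p⇒∣p-x∣<∣p∣)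
open import Data.Vec using ([]; _∷_)
open import Data.Product using (_×_; _,_; ∃; ∃₂; proj₁; proj₂)
open import Data.Sum using (_⊎_; inj₁; inj₂)
open import Data.List using (List; length; []; _∷_)
open import Data.List.Relation.Unary.All as All using (All; []; _∷_)
open import Data.List.Relation.Unary.AllPairs using (AllPairs; []; _∷_)
open import Data.List.Relation.Unary.Unique.Propositional using (Unique)
open import Data.List.Relation.Binary.Sublist.Propositional
  using ([]; _∷_; _∷ʳ_) renaming (_⊆_ to _⊑_)
open import Data.List.Relation.Binary.Sublist.Propositional.Properties using (All-resp-⊆)
open import Function using (_∘_)
open import Relation.Nullary using (yes; no)
open import Relation.Binary.PropositionalEquality
  using (_≡_; refl; sym; trans; cong; cong₂; subst; module ≡-Reasoning)

private
  variable
    n : ℕ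

module _ {a r} {A : Set a} {R : A → A → Set r} where

  AllPairs-resp-⊑ : ∀ {xs ys : List A} → xs ⊑ ys → AllPairs R ys → AllPairs R xs
  AllPairs-resp-⊑ []         []         = []
  AllPairs-resp-⊑ (_ ∷ʳ τ)   (_ ∷ rys)  = AllPairs-resp-⊑ τ rys
  AllPairs-resp-⊑ (refl ∷ τ) (ry ∷ rys) = All-resp-⊆ τ ry ∷ AllPairs-resp-⊑ τ rys

module _ {a p q} {A : Set a} {P : A → Set p} {Q : A → Set q} where

  partition-All-⊎ : ∀ {xs : List A} → All (λ x → P x ⊎ Q x) xs →
    ∃₂ λ ys zs → ys ⊑ xs × zs ⊑ xs × All P ys × All Q zs × length xs ≡ length ys + length zs
  partition-All-⊎ [] = [] , [] , [] , [] , [] , [] , refl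
  partition-All-⊎ {x ∷ _} (inj₁ px ∷ pqxs) with partition-All-⊎ pqxs
  ... | ys , zs , τ , σ , pys , qzs , eq =
    x ∷ ys , zs , refl ∷ τ , x ∷ʳ σ , px ∷ pys , qzs , cong suc eq
  partition-All-⊎ {x ∷ _} (inj₂ qx ∷ pqxs) with partition-All-⊎ pqxs
  ... | ys , zs , τ , σ , pys , qzs , eq =
    ys , x ∷ zs , x ∷ʳ τ , refl ∷ σ , pys , qx ∷ qzs , trans (cong suc eq) (sym (+-suc _ _))

∣p∣≡∣p∩q∣+∣p∩∁q∣ : (p q : Subset n) → ∣ p ∣ ≡ ∣ p ∩ q ∣ + ∣ p ∩ ∁ q ∣
∣p∣≡∣p∩q∣+∣p∩∁q∣ []            []            = refl
∣p∣≡∣p∩q∣+∣p∩∁q∣ (inside  ∷ p) (inside  ∷ q) = cong suc (∣p∣≡∣p∩q∣+∣p∩∁q∣ p q)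
∣p∣≡∣p∩q∣+∣p∩∁q∣ (inside  ∷ p) (outside ∷ q) =
  trans (cong suc (∣p∣≡∣p∩q∣+∣p∩∁q∣ p q)) (sym (+-suc _ _))
∣p∣≡∣p∩q∣+∣p∩∁q∣ (outside ∷ p) (_       ∷ q) = ∣p∣≡∣p∩q∣+∣p∩∁q∣ p q

∣p∣+∣∁p∣≡n : (p : Subset n) → ∣ p ∣ + ∣ ∁ p ∣ ≡ n
∣p∣+∣∁p∣≡n p = trans (cong (∣ p ∣ +_) (∣∁p∣≡n∸∣p∣ p)) (m+[n∸m]≡n (∣p∣≤n p))

∣p∣+length≤∣q∣ : ∀ {p q : Subset n} {xs} →
  p ⊆ q → Unique xs → All (_∈ q) xs → All (_∉ p) xs → ∣ p ∣ + length xs ≤ ∣ q ∣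
∣p∣+length≤∣q∣ p⊆q [] [] [] = subst (_≤ _) (sym (+-identityʳ _)) (p⊆q⇒∣p∣≤∣q∣ p⊆q)
∣p∣+length≤∣q∣ {p = p} {q} {x ∷ xs} p⊆q (x≢xs ∷ u) (x∈q ∷ xs∈q) (x∉p ∷ xs∉p) = begin
  ∣ p ∣ + suc (length xs) ≡⟨ +-suc _ _ ⟩
  suc (∣ p ∣ + length xs) ≤⟨ s≤s (∣p∣+length≤∣q∣ p⊆q-x u xs∈q-x xs∉p) ⟩
  suc ∣ q - x ∣           ≤⟨ x∈p⇒∣p-x∣<∣p∣ x∈q ⟩
  ∣ q ∣                   ∎
  where
  open ≤-Reasoning
  p⊆q-x : p ⊆ q - x
  p⊆q-x y∈p = x∈p∧x≢y⇒x∈p-y (p⊆q y∈p) λ { refl → x∉p y∈p }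
  xs∈q-x : All (_∈ q - x) xs
  xs∈q-x = All.zipWith (λ (y∈q , x≢y) → x∈p∧x≢y⇒x∈p-y y∈q (x≢y ∘ sym)) (xs∈q , x≢xs)

≤∧≤∧+≡+⇒≡∧≡ : ∀ {a b c d} → a ≤ c → b ≤ d → a + b ≡ c + d → a ≡ c × b ≡ d
≤∧≤∧+≡+⇒≡∧≡ {a} {b} {c} {d} a≤c b≤d eq = a≡c , +-cancelˡ-≡ a b d (trans eq (cong (_+ d) (sym a≡c)))
  where
  open ≤-Reasoning
  a≡c : a ≡ c
  a≡c = ≤-antisym a≤c (+-cancelʳ-≤ d c a (begin
    c + d ≡⟨ sym eq ⟩
    a + b ≤⟨ +-monoʳ-≤ a b≤d ⟩
    a + d ∎))

endpoints-⊑ : ∀ {M₁ M : List (Fin n × Fin n)} → M₁ ⊑ M → endpoints M₁ ⊑ endpoints M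
endpoints-⊑ []             = []
endpoints-⊑ ((i , j) ∷ʳ τ) = i ∷ʳ j ∷ʳ endpoints-⊑ τ
endpoints-⊑ (refl ∷ τ)     = refl ∷ refl ∷ endpoints-⊑ τ

module _ (g : Graph n) where

  endpoints∈V : ∀ {M} → IsMatching g M → All (_∈ V g) (endpoints M)
  endpoints∈V ([] , _) = []
  endpoints∈V (e ∷ es , _ ∷ _ ∷ u) = proj₁ (E-in g e) ∷ proj₂ (E-in g e) ∷ endpoints∈V (es , u)

  matching-⊑ : ∀ {M₁ M} → M₁ ⊑ M → Unique (endpoints M) →
    All (λ { (i , j) → E g i j }) M₁ → IsMatching g M₁
  matching-⊑ τ u es = es , AllPairs-resp-⊑ (endpoints-⊑ τ) u

  transversal-avoiding-stable : ∀ {S M} → IsStable g S → IsMatching g M →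
    ∃ λ xs → xs ⊑ endpoints M × All (_∉ S) xs × length xs ≡ length M
  transversal-avoiding-stable _ ([] , _) = [] , [] , [] , refl
  transversal-avoiding-stable {S} {(i , j) ∷ _} S-stable (e ∷ es , _ ∷ _ ∷ u)
    with transversal-avoiding-stable S-stable (es , u) | i ∈? S
  ... | xs , τ , xs∉S , eq | yes i∈S =
    j ∷ xs , i ∷ʳ refl ∷ τ , (λ j∈S → proj₂ S-stable i∈S j∈S e) ∷ xs∉S , cong suc eq
  ... | xs , τ , xs∉S , eq | no i∉S =
    i ∷ xs , refl ∷ j ∷ʳ τ , i∉S ∷ xs∉S , cong suc eq

  stable+matching≤order : ∀ {S M} → IsStable g S → IsMatching g M → ∣ S ∣ + length M ≤ ∣ V g ∣
  stable+matching≤order {S} S-stable M-matching@(_ , u)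
    with transversal-avoiding-stable S-stable M-matching
  ... | xs , τ , xs∉S , eq = subst (λ k → ∣ S ∣ + k ≤ ∣ V g ∣) eq
    (∣p∣+length≤∣q∣ (proj₁ S-stable) (AllPairs-resp-⊑ τ u)
                    (All-resp-⊆ τ (endpoints∈V M-matching)) xs∉S)

  α-unique : ∀ {a b} → IsAlpha g a → IsAlpha g b → a ≡ b
  α-unique ((S , S-stable , refl) , S-max) ((T , T-stable , refl) , T-max) =
    ≤-antisym (T-max S S-stable) (S-max T T-stable)

  stable+matching≡order⇒α×KE : ∀ {S M} → IsStable g S → IsMatching g M →
    ∣ S ∣ + length M ≡ ∣ V g ∣ → IsAlpha g ∣ S ∣ × IsKE g
  stable+matching≡order⇒α×KE {S} {M} S-stable M-matching eq =
    α , ∣ S ∣ , length M , α , (M , (M-matching , M-max) , refl) , eq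
    where
    α : IsAlpha g ∣ S ∣
    α = (S , S-stable , refl) , λ T T-stable → +-cancelʳ-≤ (length M) _ _
          (subst (_ ≤_) (sym eq) (stable+matching≤order T-stable M-matching))
    M-max : ∀ M′ → IsMatching g M′ → length M′ ≤ length M
    M-max M′ M′-matching = +-cancelˡ-≤ ∣ S ∣ _ _
          (subst (_ ≤_) (sym eq) (stable+matching≤order S-stable M′-matching))

  IsStable-∩ : ∀ {S} (h : Graph n) → (∀ {i j} → E h i j → E g i j) →
    IsStable g S → IsStable h (S ∩ V h)
  IsStable-∩ {S} h h⊆g (_ , S-indep) =
    proj₂ ∘ x∈p∩q⁻ S (V h) ,
    λ i∈ j∈ e → S-indep (proj₁ (x∈p∩q⁻ S (V h) i∈)) (proj₁ (x∈p∩q⁻ S (V h) j∈)) (h⊆g e)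

partition-matching : ∀ {M} (g₁ g₂ : Graph n) → Unique (endpoints M) →
  All (λ { (i , j) → E g₁ i j ⊎ E g₂ i j }) M →
  ∃₂ λ M₁ M₂ → IsMatching g₁ M₁ × IsMatching g₂ M₂ × length M ≡ length M₁ + length M₂
partition-matching g₁ g₂ u M⊆g₁∪g₂ with partition-All-⊎ M⊆g₁∪g₂
... | M₁ , M₂ , τ₁ , τ₂ , es₁ , es₂ , eq =
  M₁ , M₂ , matching-⊑ g₁ τ₁ u es₁ , matching-⊑ g₂ τ₂ u es₂ , eq

proposition10 : ∀ {n} (G : SimpleGraph n) (M : List (Fin n × Fin n)) (H : Subgraph G)
    → IsKE (full G)
    → IsMaxMatching (full G) M
    → All (λ { (i , j) → EH H i j ⊎ E (minus G H) i j }) M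
    → (IsKE (asGraph H) × IsKE (minus G H))
      × (∀ a b c → IsAlpha (full G) a → IsAlpha (asGraph H) b → IsAlpha (minus G H) c
           → a ≡ b + c)
proposition10 {n} G M H
  (_ , _ , α-G@((S , S-stable , refl) , _) , (M₀ , (M₀-matching , M₀-max) , refl) , α+μ≡n)
  (M-matching@(_ , u) , M-max) M⊆H∪G-H
  with partition-matching (asGraph H) (minus G H) u M⊆H∪G-H
... | M₁ , M₂ , M₁-matching , M₂-matching , M≡M₁+M₂ =
  (proj₂ H-tight , proj₂ G-H-tight) , λ a b c α-G′ α-H α-G-H → begin
    a               ≡⟨ α-unique (full G) α-G′ α-G ⟩
    ∣ S ∣           ≡⟨ ∣p∣≡∣p∩q∣+∣p∩∁q∣ S (VH H) ⟩
    ∣ S₁ ∣ + ∣ S₂ ∣ ≡⟨ cong₂ _+_ (α-unique (asGraph H) (proj₁ H-tight) α-H)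
                                (α-unique (minus G H) (proj₁ G-H-tight) α-G-H) ⟩
    b + c           ∎
  where
  open ≡-Reasoning
  S₁ S₂ : Subset n
  S₁ = S ∩ VH H
  S₂ = S ∩ ∁ (VH H)
  S₁-stable : IsStable (asGraph H) S₁
  S₁-stable = IsStable-∩ (full G) (asGraph H) (EH⊆E H) S-stable
  S₂-stable : IsStable (minus G H) S₂
  S₂-stable = IsStable-∩ (full G) (minus G H) proj₁ S-stable
  ∣M∣≡∣M₀∣ : length M ≡ length M₀
  ∣M∣≡∣M₀∣ = ≤-antisym (M₀-max M M-matching) (M-max M₀ M₀-matching)
  counts : (∣ S₁ ∣ + length M₁) + (∣ S₂ ∣ + length M₂) ≡ ∣ VH H ∣ + ∣ ∁ (VH H) ∣
  counts = begin
    (∣ S₁ ∣ + length M₁) + (∣ S₂ ∣ + length M₂) ≡⟨ +-interchange ∣ S₁ ∣ _ _ _ ⟩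
    (∣ S₁ ∣ + ∣ S₂ ∣) + (length M₁ + length M₂) ≡⟨ cong₂ _+_ (sym (∣p∣≡∣p∩q∣+∣p∩∁q∣ S (VH H)))
                                                            (sym M≡M₁+M₂) ⟩
    ∣ S ∣ + length M                            ≡⟨ cong (∣ S ∣ +_) ∣M∣≡∣M₀∣ ⟩
    ∣ S ∣ + length M₀                           ≡⟨ α+μ≡n ⟩
    ∣ V (full G) ∣                              ≡⟨ ∣⊤∣≡n n ⟩
    n                                           ≡⟨ ∣p∣+∣∁p∣≡n (VH H) ⟨
    ∣ VH H ∣ + ∣ ∁ (VH H) ∣                     ∎
  tight : ∣ S₁ ∣ + length M₁ ≡ ∣ VH H ∣ × ∣ S₂ ∣ + length M₂ ≡ ∣ ∁ (VH H) ∣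
  tight = ≤∧≤∧+≡+⇒≡∧≡ (stable+matching≤order (asGraph H) S₁-stable M₁-matching)
                      (stable+matching≤order (minus G H) S₂-stable M₂-matching) counts
  H-tight : IsAlpha (asGraph H) ∣ S₁ ∣ × IsKE (asGraph H)
  H-tight = stable+matching≡order⇒α×KE (asGraph H) S₁-stable M₁-matching (proj₁ tight)
  G-H-tight : IsAlpha (minus G H) ∣ S₂ ∣ × IsKE (minus G H)
  G-H-tight = stable+matching≡order⇒α×KE (minus G H) S₂-stable M₂-matching (proj₂ tight)
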